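{- Let $P=\{p_1,\dots,p_d\}$ be a finite poset and let $\mathcal{Q}\subset\mathbb{R}^d$ be a lattice polytope containing the origin. Then the Cayley sum $\mathcal{O}_P*\mathcal{Q}$ is unimodularly equivalent to $\mathrm{conv}\{\mathcal{O}_{P'}\cup(-\mathcal{Q}\times\{0\})\}\subset\mathbb{R}^{d+1}$, where $P'=\{p_{d+1}\}\oplus P^*$.
   Context: For a poset $R=\{r_1,\dots,r_n\}$ and $X\subset R$, let $\rho(X)=\sum_{r_j\in X}\mathbf{e}_j\in\mathbb{R}^n$. A poset ideal of $R$ is a down-closed subset (including $\emptyset$ and $R$); the order polytope $\mathcal{O}_R\subset\mathbb{R}^n$ is the convex hull of $\{\rho(I):I\text{ a poset ideal of }R\}$. The Cayley sum $\mathcal{O}_P*\mathcal{Q}\subset\mathbb{R}^{d+1}$ is the convex hull of $(\mathcal{O}_P\times\{1\})\cup(\mathcal{Q}\times\{0\})$. The dual poset $P^*$ has the same underlying set as $P$ with $s\le_{P^*}t$ iff $t\le_P s$. For disjoint posets $A,B$, the ordinal sum $A\oplus B$ is the poset on $A\cup B$ in which $s\le t$ iff ($s,t\in A$ and $s\le_A t$) or ($s,t\in B$ and $s\le_B t$) or ($s\in A$, $t\in B$). Thus $P'$ is the poset on $\{p_1,\dots,p_{d+1}\}$ whose element $p_{d+1}$ is below all others and whose restriction to $\{p_1,\dots,p_d\}$ is $P^*$; its order polytope lies in $\mathbb{R}^{d+1}$. Two lattice polytopes are unimodularly equivalent if there is an affine map $f:\mathbb{R}^{d+1}\to\mathbb{R}^{d+1}$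 with $f(\mathbb{Z}^{d+1})=\mathbb{Z}^{d+1}$ mapping one onto the other.
   Formalization: The polytopes are taken as their sets of points in ℚ^(d+1) in place of ℝ^(d+1), and the affine map f has rational coefficients. -}

module Defs where

open import Data.Nat using (ℕ; zero; suc)
open import Data.Fin using (Fin; zero; suc; fromℕ; inject₁)
open import Data.Integer using (ℤ)
open import Data.Rational using (ℚ; 0ℚ; 1ℚ; _+_; _*_; -_; _≤_; _/_)
open import Data.Bool using (Bool; true; false; if_then_else_)
open import Data.List using (List; []; _∷_; map; foldr)
open import Data.List.Relation.Unary.All using (All)
open import Data.List.Membership.Propositional using (_∈_)
open import Data.Product using (Σ; ∃; _×_; _,_; proj₁; proj₂)
open import Data.Sum using (_⊎_)
open import Relation.Binary.PropositionalEquality using (_≡_)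

Pt : ℕ → Set
Pt n = Fin n → ℚ

_≈ₚ_ : ∀ {n} → Pt n → Pt n → Set
x ≈ₚ y = ∀ i → x i ≡ y i

Region : ℕ → Set₁
Region n = Pt n → Set

ZPt : ℕ → Set
ZPt n = Fin n → ℤ

ι : ∀ {n} → ZPt n → Pt n
ι z i = z i / 1

IsLatticePt : ∀ {n} → Pt n → Set
IsLatticePt {n} x = Σ (ZPt n) λ z → x ≈ₚ ι z

sumℚ : List ℚ → ℚ
sumℚ = foldr _+_ 0ℚ

lincomb : ∀ {n} → List (ℚ × Pt n) → Pt n
lincomb cs i = sumℚ (map (λ c → proj₁ c * proj₂ c i) cs)

conv : ∀ {n} → Region n → Region n
conv S x = Σ (List (ℚ × Pt _)) λ cs →
    All (λ c → 0ℚ ≤ proj₁ c) cs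
  × All (λ c → S (proj₂ c)) cs
  × sumℚ (map proj₁ cs) ≡ 1ℚ
  × x ≈ₚ lincomb cs

_∪_ : ∀ {n} → Region n → Region n → Region n
(S ∪ T) x = S x ⊎ T x

negR : ∀ {n} → Region n → Region n
negR S x = S (λ i → - x i)

snocP : ∀ {n} → Pt n → ℚ → Pt (suc n)
snocP {zero}  y c zero    = c
snocP {suc n} y c zero    = y zero
snocP {suc n} y c (suc i) = snocP (λ j → y (suc j)) c i

_×at_ : ∀ {n} → Region n → ℚ → Region (suc n)
(S ×at c) x = Σ (Pt _) λ y → S y × (x ≈ₚ snocP y c)

latticePolytope : ∀ {n} → List (ZPt n) → Region n
latticePolytope V = conv (λ x → Σ (ZPt _) λ v → v ∈ V × (x ≈ₚ ι v))

-- Posets on Fin n are given by a relation (with IsPartialOrder _≡_ R).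
Rel : ℕ → Set₁
Rel n = Fin n → Fin n → Set

IsIdeal : ∀ {n} → Rel n → (Fin n → Bool) → Set
IsIdeal R I = ∀ s t → R t s → I s ≡ true → I t ≡ true

ρ : ∀ {n} → (Fin n → Bool) → Pt n
ρ X i = if X i then 1ℚ else 0ℚ

orderPolytope : ∀ {n} → Rel n → Region n
orderPolytope R = conv (λ x → Σ (_ → Bool) λ I → IsIdeal R I × (x ≈ₚ ρ I))

cayley : ∀ {n} → Region n → Region n → Region (suc n)
cayley A B = conv ((A ×at 1ℚ) ∪ (B ×at 0ℚ))

dual : ∀ {n} → Rel n → Rel n
dual R s t = R t s

-- P' = {p_{d+1}} ⊕ P* on Fin (suc d): p_i (i ≤ d) is coordinate inject₁ i,
-- p_{d+1} is the last coordinate fromℕ d.  Ordinal sum: s ≤ t iff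
-- s = p_{d+1} (below everything, including itself), or s,t ∈ P with s ≤_{P*} t.
primeP : ∀ {d} → Rel d → Rel (suc d)
primeP {d} R s t =
  (s ≡ fromℕ d)
  ⊎ (Σ (Fin d) λ i → Σ (Fin d) λ j → s ≡ inject₁ i × t ≡ inject₁ j × dual R i j)

record Affine (n : ℕ) : Set where
  field
    mat : Fin n → Fin n → ℚ
    vec : Pt n

applyAff : ∀ {n} → Affine n → Pt n → Pt n
applyAff {zero}  f x ()
applyAff {suc n} f x i =
  sumℚ (Data.List.map (λ j → Affine.mat f i j * x j) (Data.List.allFin (suc n))) + Affine.vec f i

LatticePreserving : ∀ {n} → Affine n → Set
LatticePreserving {n} f =
    (∀ (z : ZPt n) → IsLatticePt (applyAff f (ι z)))
  × (∀ (w : ZPt n) → Σ (ZPt n) λ z → applyAff f (ι z) ≈ₚ ι w)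

MapsOnto : ∀ {n} → Affine n → Region n → Region n → Set
MapsOnto f S T =
    (∀ x → S x → T (applyAff f x))
  × (∀ y → T y → Σ (Pt _) λ x → S x × (applyAff f x ≈ₚ y))

UnimodEquiv : ∀ {n} → Region n → Region n → Set
UnimodEquiv {n} S T = Σ (Affine n) λ f → LatticePreserving f × MapsOnto f S T

-- The unimodular map is the linear involution φ(y , t) = (t𝟙 − y , t) of ℚ^(d+1).
-- At height 1 it complements coordinates, y ↦ 𝟙 − y, so a vertex ρ(I) × {1} of
-- O_P × {1} goes to ρ(I′) where I′ = (P ∖ I) ∪ {p_{d+1}} is an ideal of P′; at
-- height 0 it is y ↦ −y, exchanging 𝒬 × {0} and −𝒬 × {0}. Conversely an ideal
-- of P′ either contains p_{d+1}, and is such an I′, or is empty (p_{d+1} lies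
-- below everything), and ρ(∅) = 0 ∈ 𝒬 × {0}. Since φ is affine it commutes with
-- convex hulls, and since φ ∘ φ = id it is a bijection of ℤ^(d+1).
module Submission where

open import Defs
open import Data.Nat using (ℕ; zero; suc)
open import Data.Fin using (Fin; zero; suc; fromℕ; inject₁; punchIn)
open import Data.Fin.Properties using (_≟_)
open import Data.Fin.Relation.Unary.Top using (view; ‵fromℕ; ‵inject₁)
import Data.Integer as ℤ
import Data.Integer.Properties as ℤ
import Data.Nat.Coprimality as Coprime
open import Data.Rational using (ℚ; 0ℚ; 1ℚ; mkℚ; _+_; _*_; -_; _-_; _/_; _≤_; nonNegative)
import Data.Rational.Properties as ℚ
open import Algebra.Properties.Group ℚ.+-0-group using () renaming (⁻¹-involutive to neg-involutive)
open import Data.Rational.Solver using (module +-*-Solver)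
open import Data.Bool using (Bool; true; false; not; if_then_else_)
open import Data.List using (List; []; _∷_; map; _++_; allFin)
import Data.List.Properties as List
open import Data.List.Relation.Unary.All as All using (All; []; _∷_)
import Data.List.Relation.Unary.All.Properties as All
open import Data.Vec.Functional using (insertAt)
open import Data.Vec.Functional.Properties using (insertAt-lookup; insertAt-punchIn)
open import Data.Product using (Σ; _×_; _,_; proj₁; proj₂)
open import Data.Sum using (inj₁; inj₂)
open import Function using (_∘_)
open import Relation.Nullary using (does)
open import Relation.Binary.PropositionalEquality
  using (_≡_; refl; sym; trans; cong; cong₂; module ≡-Reasoning)
open import Relation.Binary.Structures using (IsPartialOrder)

open +-*-Solver using (solve; _:+_; _:-_; _:*_; _:=_)

*-distribˡ-− : ∀ l a b → l * (a - b) ≡ l * a - l * b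
*-distribˡ-− = solve 3 (λ l a b → l :* (a :- b) := l :* a :- l :* b) refl

*-distribʳ-− : ∀ x a b → (a - b) * x ≡ a * x - b * x
*-distribʳ-− = solve 3 (λ x a b → (a :- b) :* x := a :* x :- b :* x) refl

sumℚ-++ : ∀ xs ys → sumℚ (xs ++ ys) ≡ sumℚ xs + sumℚ ys
sumℚ-++ []       ys = sym (ℚ.+-identityˡ _)
sumℚ-++ (x ∷ xs) ys = trans (cong (x +_) (sumℚ-++ xs ys)) (sym (ℚ.+-assoc x _ _))

module _ {A : Set} where

  sumℚ-map-cong : ∀ {f g : A → ℚ} → (∀ c → f c ≡ g c) → ∀ xs →
                  sumℚ (map f xs) ≡ sumℚ (map g xs)
  sumℚ-map-cong f≗g xs = cong sumℚ (List.map-cong f≗g xs)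

  sumℚ-map-zero : ∀ {f : A → ℚ} → (∀ c → f c ≡ 0ℚ) → ∀ xs → sumℚ (map f xs) ≡ 0ℚ
  sumℚ-map-zero f≗0 []       = refl
  sumℚ-map-zero f≗0 (x ∷ xs) =
    trans (cong₂ _+_ (f≗0 x) (sumℚ-map-zero f≗0 xs)) (ℚ.+-identityˡ 0ℚ)

  sumℚ-map-*ˡ : ∀ k (f : A → ℚ) xs → sumℚ (map (λ c → k * f c) xs) ≡ k * sumℚ (map f xs)
  sumℚ-map-*ˡ k f []       = sym (ℚ.*-zeroʳ k)
  sumℚ-map-*ˡ k f (x ∷ xs) =
    trans (cong (k * f x +_) (sumℚ-map-*ˡ k f xs)) (sym (ℚ.*-distribˡ-+ k (f x) _))

  sumℚ-map-− : ∀ (f g : A → ℚ) xs →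
               sumℚ (map (λ c → f c - g c) xs) ≡ sumℚ (map f xs) - sumℚ (map g xs)
  sumℚ-map-− f g []       = refl
  sumℚ-map-− f g (x ∷ xs) =
    trans (cong (f x - g x +_) (sumℚ-map-− f g xs))
          (solve 4 (λ a b s t → (a :- b) :+ (s :- t) := (a :+ s) :- (b :+ t)) refl
                 (f x) (g x) (sumℚ (map f xs)) (sumℚ (map g xs)))

unit : ∀ {n} → Fin n → Pt n
unit j = ρ (λ i → does (i ≟ j))

sumℚ-allFin-suc : ∀ {n} (h : Fin (suc n) → ℚ) →
                  sumℚ (map h (allFin (suc n))) ≡ h zero + sumℚ (map (h ∘ suc) (allFin n))
sumℚ-allFin-suc h = cong (λ hs → h zero + sumℚ hs)
  (trans (List.map-tabulate suc h) (sym (List.map-tabulate (λ j → j) (h ∘ suc))))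

sumℚ-unit : ∀ {n} (x : Pt n) i → sumℚ (map (λ j → unit j i * x j) (allFin n)) ≡ x i
sumℚ-unit {suc n} x zero = begin
  sumℚ (map (λ j → unit j zero * x j) (allFin (suc n)))
    ≡⟨ sumℚ-allFin-suc (λ j → unit j zero * x j) ⟩
  1ℚ * x zero + sumℚ (map (λ j → 0ℚ * x (suc j)) (allFin n))
    ≡⟨ cong₂ _+_ (ℚ.*-identityˡ (x zero)) (sumℚ-map-zero (λ j → ℚ.*-zeroˡ (x (suc j))) (allFin n)) ⟩
  x zero + 0ℚ
    ≡⟨ ℚ.+-identityʳ (x zero) ⟩
  x zero ∎
  where open ≡-Reasoning
sumℚ-unit {suc n} x (suc i) = begin
  sumℚ (map (λ j → unit j (suc i) * x j) (allFin (suc n)))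
    ≡⟨ sumℚ-allFin-suc (λ j → unit j (suc i) * x j) ⟩
  0ℚ * x zero + sumℚ (map (λ j → unit j i * x (suc j)) (allFin n))
    ≡⟨ cong₂ _+_ (ℚ.*-zeroˡ (x zero)) (sumℚ-unit (x ∘ suc) i) ⟩
  0ℚ + x (suc i)
    ≡⟨ ℚ.+-identityˡ (x (suc i)) ⟩
  x (suc i) ∎
  where open ≡-Reasoning

conv-resp-≈ₚ : ∀ {n} {S : Region n} {x y} → x ≈ₚ y → conv S x → conv S y
conv-resp-≈ₚ x≈y (cs , ≥0 , ∈S , Σ≡1 , x≈) = cs , ≥0 , ∈S , Σ≡1 , λ i → trans (sym (x≈y i)) (x≈ i)

conv-extensive : ∀ {n} {S : Region n} {x} → S x → conv S x
conv-extensive {x = x} x∈S =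
  (1ℚ , x) ∷ [] , ℚ.nonNegative⁻¹ 1ℚ ∷ [] , x∈S ∷ [] , refl ,
  λ i → sym (trans (ℚ.+-identityʳ _) (ℚ.*-identityˡ (x i)))

scaleWeights : ∀ {n} → ℚ → List (ℚ × Pt n) → List (ℚ × Pt n)
scaleWeights l = map (λ (m , z) → l * m , z)

weights-scaleWeights : ∀ {n} l (cs : List (ℚ × Pt n)) →
                       sumℚ (map proj₁ (scaleWeights l cs)) ≡ l * sumℚ (map proj₁ cs)
weights-scaleWeights l cs = trans (cong sumℚ (sym (List.map-∘ cs))) (sumℚ-map-*ˡ l proj₁ cs)

lincomb-scaleWeights : ∀ {n} l (cs : List (ℚ × Pt n)) i →
                       lincomb (scaleWeights l cs) i ≡ l * lincomb cs i
lincomb-scaleWeights l cs i =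
  trans (cong sumℚ (sym (List.map-∘ cs)))
        (trans (sumℚ-map-cong (λ (m , z) → ℚ.*-assoc l m (z i)) cs)
               (sumℚ-map-*ˡ l (λ (m , z) → m * z i) cs))

flatten : ∀ {n} {S : Region n} (cs : List (ℚ × Pt n)) →
          All (λ c → 0ℚ ≤ proj₁ c) cs → All (λ c → conv S (proj₂ c)) cs →
          Σ (List (ℚ × Pt n)) λ es →
            All (λ c → 0ℚ ≤ proj₁ c) es × All (λ c → S (proj₂ c)) es
          × sumℚ (map proj₁ es) ≡ sumℚ (map proj₁ cs) × lincomb es ≈ₚ lincomb cs
flatten [] [] [] = [] , [] , [] , refl , λ i → refl
flatten ((l , y) ∷ cs) (l≥0 ∷ ≥0) ((ds , ds≥0 , ds∈S , Σds≡1 , y≈) ∷ ∈convS)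
  with flatten cs ≥0 ∈convS
... | es , es≥0 , es∈S , Σes , es≈ =
  scaleWeights l ds ++ es ,
  All.++⁺ (All.map⁺ (All.map (nonNeg* l≥0) ds≥0)) es≥0 ,
  All.++⁺ (All.map⁺ ds∈S) es∈S ,
  (begin
    sumℚ (map proj₁ (scaleWeights l ds ++ es))
      ≡⟨ cong sumℚ (List.map-++ proj₁ (scaleWeights l ds) es) ⟩
    sumℚ (map proj₁ (scaleWeights l ds) ++ map proj₁ es)
      ≡⟨ sumℚ-++ (map proj₁ (scaleWeights l ds)) _ ⟩
    sumℚ (map proj₁ (scaleWeights l ds)) + sumℚ (map proj₁ es)
      ≡⟨ cong₂ _+_ (weights-scaleWeights l ds) Σes ⟩
    l * sumℚ (map proj₁ ds) + sumℚ (map proj₁ cs)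
      ≡⟨ cong (λ w → l * w + _) Σds≡1 ⟩
    l * 1ℚ + sumℚ (map proj₁ cs)
      ≡⟨ cong (_+ _) (ℚ.*-identityʳ l) ⟩
    l + sumℚ (map proj₁ cs) ∎) ,
  λ i → begin
    lincomb (scaleWeights l ds ++ es) i
      ≡⟨ cong sumℚ (List.map-++ (λ c → proj₁ c * proj₂ c i) (scaleWeights l ds) es) ⟩
    sumℚ (map (λ c → proj₁ c * proj₂ c i) (scaleWeights l ds) ++ map (λ c → proj₁ c * proj₂ c i) es)
      ≡⟨ sumℚ-++ (map (λ c → proj₁ c * proj₂ c i) (scaleWeights l ds)) _ ⟩
    lincomb (scaleWeights l ds) i + lincomb es i
      ≡⟨ cong₂ _+_ (lincomb-scaleWeights l ds i) (es≈ i) ⟩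
    l * lincomb ds i + lincomb cs i
      ≡⟨ cong (λ u → l * u + _) (sym (y≈ i)) ⟩
    l * y i + lincomb cs i ∎
  where
  open ≡-Reasoning
  nonNeg* : ∀ {p q} → 0ℚ ≤ p → 0ℚ ≤ q → 0ℚ ≤ p * q
  nonNeg* {p} {q} p≥0 q≥0 = ℚ.nonNegative⁻¹ (p * q)
    {{ℚ.nonNeg*nonNeg⇒nonNeg p {{nonNegative p≥0}} q {{nonNegative q≥0}}}}

conv-idempotent : ∀ {n} {S : Region n} {x} → conv (conv S) x → conv S x
conv-idempotent (cs , ≥0 , ∈convS , Σ≡1 , x≈) with flatten cs ≥0 ∈convS
... | es , es≥0 , es∈S , Σes , es≈ =
  es , es≥0 , es∈S , trans Σes Σ≡1 , λ i → trans (x≈ i) (sym (es≈ i))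

IsAffineFunctional : ∀ {n} → (Pt n → ℚ) → Set
IsAffineFunctional {n} h = ∀ (cs : List (ℚ × Pt n)) → sumℚ (map proj₁ cs) ≡ 1ℚ →
  h (lincomb cs) ≡ sumℚ (map (λ c → proj₁ c * h (proj₂ c)) cs)

coordinate-affine : ∀ {n} (j : Fin n) → IsAffineFunctional (λ x → x j)
coordinate-affine j cs _ = refl

const-affine : ∀ {n} k → IsAffineFunctional {n} (λ _ → k)
const-affine k cs Σ≡1 = sym (begin
  sumℚ (map (λ c → proj₁ c * k) cs) ≡⟨ sumℚ-map-cong (λ c → ℚ.*-comm (proj₁ c) k) cs ⟩
  sumℚ (map (λ c → k * proj₁ c) cs) ≡⟨ sumℚ-map-*ˡ k proj₁ cs ⟩
  k * sumℚ (map proj₁ cs)           ≡⟨ cong (k *_) Σ≡1 ⟩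
  k * 1ℚ                            ≡⟨ ℚ.*-identityʳ k ⟩
  k                                 ∎)
  where open ≡-Reasoning

−-affine : ∀ {n} {g h : Pt n → ℚ} →
           IsAffineFunctional g → IsAffineFunctional h → IsAffineFunctional (λ x → g x - h x)
−-affine {g = g} {h} g-aff h-aff cs Σ≡1 = begin
  g (lincomb cs) - h (lincomb cs)
    ≡⟨ cong₂ _-_ (g-aff cs Σ≡1) (h-aff cs Σ≡1) ⟩
  sumℚ (map (λ c → proj₁ c * g (proj₂ c)) cs) - sumℚ (map (λ c → proj₁ c * h (proj₂ c)) cs)
    ≡⟨ sym (sumℚ-map-− (λ c → proj₁ c * g (proj₂ c)) (λ c → proj₁ c * h (proj₂ c)) cs) ⟩
  sumℚ (map (λ c → proj₁ c * g (proj₂ c) - proj₁ c * h (proj₂ c)) cs)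
    ≡⟨ sumℚ-map-cong (λ c → sym (*-distribˡ-− (proj₁ c) (g (proj₂ c)) (h (proj₂ c)))) cs ⟩
  sumℚ (map (λ c → proj₁ c * (g (proj₂ c) - h (proj₂ c))) cs) ∎
  where open ≡-Reasoning

affine-resp-≗ : ∀ {n} {g h : Pt n → ℚ} → (∀ x → g x ≡ h x) →
                IsAffineFunctional h → IsAffineFunctional g
affine-resp-≗ g≗h h-aff cs Σ≡1 =
  trans (g≗h _) (trans (h-aff cs Σ≡1)
    (sumℚ-map-cong (λ c → cong (proj₁ c *_) (sym (g≗h (proj₂ c)))) cs))

conv-map : ∀ {m n} {S : Region m} {T : Region n} (g : Pt m → Pt n) →
           (∀ {x y} → x ≈ₚ y → g x ≈ₚ g y) → (∀ i → IsAffineFunctional (λ x → g x i)) →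
           (∀ {y} → S y → T (g y)) → ∀ {x} → conv S x → conv T (g x)
conv-map g g-cong g-aff g[S]⊆T (cs , ≥0 , ∈S , Σ≡1 , x≈) =
  map (λ (m , z) → m , g z) cs ,
  All.map⁺ ≥0 ,
  All.map⁺ (All.map g[S]⊆T ∈S) ,
  trans (cong sumℚ (sym (List.map-∘ cs))) Σ≡1 ,
  λ i → trans (g-cong x≈ i) (trans (g-aff i cs Σ≡1) (cong sumℚ (List.map-∘ cs)))

punchIn-fromℕ : ∀ {n} (j : Fin n) → punchIn (fromℕ n) j ≡ inject₁ j
punchIn-fromℕ zero    = refl
punchIn-fromℕ (suc j) = cong suc (punchIn-fromℕ j)

ext-fromℕ-inject₁ : ∀ {A : Set} {n} {x y : Fin (suc n) → A} →
                    x (fromℕ n) ≡ y (fromℕ n) → (∀ j → x (inject₁ j) ≡ y (inject₁ j)) →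
                    ∀ i → x i ≡ y i
ext-fromℕ-inject₁ top≡ inject₁≡ i with view i
... | ‵fromℕ     = top≡
... | ‵inject₁ j = inject₁≡ j

snoc : ∀ {A : Set} {n} → (Fin n → A) → A → Fin (suc n) → A
snoc y c = insertAt y (fromℕ _) c

snoc-fromℕ : ∀ {A : Set} {n} (y : Fin n → A) c → snoc y c (fromℕ n) ≡ c
snoc-fromℕ y c = insertAt-lookup y (fromℕ _) c

snoc-inject₁ : ∀ {A : Set} {n} (y : Fin n → A) c j → snoc y c (inject₁ j) ≡ y j
snoc-inject₁ y c j =
  trans (cong (snoc y c) (sym (punchIn-fromℕ j))) (insertAt-punchIn y (fromℕ _) c j)

snocP-fromℕ : ∀ {n} (y : Pt n) c → snocP y c (fromℕ n) ≡ c
snocP-fromℕ {zero}  y c = refl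
snocP-fromℕ {suc n} y c = snocP-fromℕ (λ j → y (suc j)) c

snocP-inject₁ : ∀ {n} (y : Pt n) c j → snocP y c (inject₁ j) ≡ y j
snocP-inject₁ {suc n} y c zero    = refl
snocP-inject₁ {suc n} y c (suc j) = snocP-inject₁ (λ j → y (suc j)) c j

snocP-cong : ∀ {n} {y z : Pt n} c → y ≈ₚ z → snocP y c ≈ₚ snocP z c
snocP-cong {y = y} {z} c y≈z = ext-fromℕ-inject₁
  (trans (snocP-fromℕ y c) (sym (snocP-fromℕ z c)))
  (λ j → trans (snocP-inject₁ y c j) (trans (y≈z j) (sym (snocP-inject₁ z c j))))

/1-mkℚ : ∀ a → a / 1 ≡ mkℚ a 0 (Coprime.sym (Coprime.1-coprimeTo ℤ.∣ a ∣))
/1-mkℚ a = ℚ.↥p/↧p≡p (mkℚ a 0 (Coprime.sym (Coprime.1-coprimeTo ℤ.∣ a ∣)))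

/1-homo-+ : ∀ a b → (a ℤ.+ b) / 1 ≡ a / 1 + b / 1
/1-homo-+ a b rewrite /1-mkℚ a | /1-mkℚ b =
  cong (_/ 1) (sym (cong₂ ℤ._+_ (ℤ.*-identityʳ a) (ℤ.*-identityʳ b)))

/1-homo-neg : ∀ a → (ℤ.- a) / 1 ≡ - (a / 1)
/1-homo-neg a = trans (/1-mkℚ (ℤ.- a)) (trans (mkℚ-neg a) (cong -_ (sym (/1-mkℚ a))))
  where
  mkℚ-neg : ∀ a → mkℚ (ℤ.- a) 0 (Coprime.sym (Coprime.1-coprimeTo ℤ.∣ ℤ.- a ∣))
                 ≡ - mkℚ a 0 (Coprime.sym (Coprime.1-coprimeTo ℤ.∣ a ∣))
  mkℚ-neg (ℤ.+ zero)  = refl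
  mkℚ-neg (ℤ.+ suc n) = refl
  mkℚ-neg ℤ.-[1+ n ]  = refl

/1-homo-− : ∀ a b → (a ℤ.- b) / 1 ≡ a / 1 - b / 1
/1-homo-− a b = trans (/1-homo-+ a (ℤ.- b)) (cong (a / 1 +_) (/1-homo-neg b))

module Flip {d : ℕ} where

  top : Fin (suc d)
  top = fromℕ d

  φ : Pt (suc d) → Pt (suc d)
  φ x = snoc (λ j → x top - x (inject₁ j)) (x top)

  φ-top : ∀ x → φ x top ≡ x top
  φ-top x = snoc-fromℕ (λ j → x top - x (inject₁ j)) (x top)

  φ-inject₁ : ∀ x j → φ x (inject₁ j) ≡ x top - x (inject₁ j)
  φ-inject₁ x j = snoc-inject₁ (λ j → x top - x (inject₁ j)) (x top) j

  φ-cong : ∀ {x y} → x ≈ₚ y → φ x ≈ₚ φ y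
  φ-cong {x} {y} x≈y = ext-fromℕ-inject₁
    (trans (φ-top x) (trans (x≈y top) (sym (φ-top y))))
    (λ j → trans (φ-inject₁ x j)
             (trans (cong₂ _-_ (x≈y top) (x≈y (inject₁ j))) (sym (φ-inject₁ y j))))

  φ-affine : ∀ i → IsAffineFunctional (λ x → φ x i)
  φ-affine i with view i
  ... | ‵fromℕ     = affine-resp-≗ φ-top (coordinate-affine top)
  ... | ‵inject₁ j = affine-resp-≗ (λ x → φ-inject₁ x j)
                       (−-affine (coordinate-affine top) (coordinate-affine (inject₁ j)))

  φ-involutive : ∀ x → φ (φ x) ≈ₚ x
  φ-involutive x = ext-fromℕ-inject₁ (trans (φ-top (φ x)) (φ-top x)) λ j → begin
    φ (φ x) (inject₁ j)              ≡⟨ φ-inject₁ (φ x) j ⟩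
    φ x top - φ x (inject₁ j)        ≡⟨ cong₂ _-_ (φ-top x) (φ-inject₁ x j) ⟩
    x top - (x top - x (inject₁ j))  ≡⟨ solve 2 (λ a b → a :- (a :- b) := b) refl
                                               (x top) (x (inject₁ j)) ⟩
    x (inject₁ j)                    ∎
    where open ≡-Reasoning

  φ-height₀ : ∀ {x} (y : Pt d) → x ≈ₚ snocP y 0ℚ → φ x ≈ₚ snocP (λ j → - y j) 0ℚ
  φ-height₀ {x} y x≈ = ext-fromℕ-inject₁
    (trans (φ-top x) (trans (x≈ top)
      (trans (snocP-fromℕ y 0ℚ) (sym (snocP-fromℕ (λ j → - y j) 0ℚ)))))
    λ j → begin
    φ x (inject₁ j)           ≡⟨ φ-inject₁ x j ⟩
    x top - x (inject₁ j)     ≡⟨ cong₂ _-_ (trans (x≈ top) (snocP-fromℕ y 0ℚ))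
                                           (trans (x≈ (inject₁ j)) (snocP-inject₁ y 0ℚ j)) ⟩
    0ℚ - y j                  ≡⟨ ℚ.+-identityˡ (- y j) ⟩
    - y j                     ≡⟨ sym (snocP-inject₁ (λ j → - y j) 0ℚ j) ⟩
    snocP (λ j → - y j) 0ℚ (inject₁ j) ∎
    where open ≡-Reasoning

  φ₁ : Pt d → Pt (suc d)
  φ₁ y = φ (snocP y 1ℚ)

  φ₁-top : ∀ y → φ₁ y top ≡ 1ℚ
  φ₁-top y = trans (φ-top (snocP y 1ℚ)) (snocP-fromℕ y 1ℚ)

  φ₁-inject₁ : ∀ y j → φ₁ y (inject₁ j) ≡ 1ℚ - y j
  φ₁-inject₁ y j =
    trans (φ-inject₁ (snocP y 1ℚ) j) (cong₂ _-_ (snocP-fromℕ y 1ℚ) (snocP-inject₁ y 1ℚ j))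

  φ₁-cong : ∀ {y z} → y ≈ₚ z → φ₁ y ≈ₚ φ₁ z
  φ₁-cong y≈z = φ-cong (snocP-cong 1ℚ y≈z)

  φ₁-affine : ∀ i → IsAffineFunctional (λ y → φ₁ y i)
  φ₁-affine i with view i
  ... | ‵fromℕ     = affine-resp-≗ φ₁-top (const-affine 1ℚ)
  ... | ‵inject₁ j = affine-resp-≗ (λ y → φ₁-inject₁ y j)
                       (−-affine (const-affine 1ℚ) (coordinate-affine j))

  φ-affineMap : Affine (suc d)
  φ-affineMap = record { mat = λ i j → φ (unit j) i ; vec = λ _ → 0ℚ }

  applyAff-φ : ∀ x → applyAff φ-affineMap x ≈ₚ φ x
  applyAff-φ x = ext-fromℕ-inject₁ top≡ inject₁≡
    where
    open ≡-Reasoning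
    top≡ : applyAff φ-affineMap x top ≡ φ x top
    top≡ = begin
      sumℚ (map (λ j → φ (unit j) top * x j) (allFin (suc d))) + 0ℚ
        ≡⟨ ℚ.+-identityʳ _ ⟩
      sumℚ (map (λ j → φ (unit j) top * x j) (allFin (suc d)))
        ≡⟨ sumℚ-map-cong (λ j → cong (_* x j) (φ-top (unit j))) (allFin (suc d)) ⟩
      sumℚ (map (λ j → unit j top * x j) (allFin (suc d)))
        ≡⟨ sumℚ-unit x top ⟩
      x top
        ≡⟨ sym (φ-top x) ⟩
      φ x top ∎
    inject₁≡ : ∀ k → applyAff φ-affineMap x (inject₁ k) ≡ φ x (inject₁ k)
    inject₁≡ k = begin
      sumℚ (map (λ j → φ (unit j) (inject₁ k) * x j) (allFin (suc d))) + 0ℚ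
        ≡⟨ ℚ.+-identityʳ _ ⟩
      sumℚ (map (λ j → φ (unit j) (inject₁ k) * x j) (allFin (suc d)))
        ≡⟨ sumℚ-map-cong (λ j → trans (cong (_* x j) (φ-inject₁ (unit j) k))
                                      (*-distribʳ-− (x j) (unit j top) (unit j (inject₁ k))))
                         (allFin (suc d)) ⟩
      sumℚ (map (λ j → unit j top * x j - unit j (inject₁ k) * x j) (allFin (suc d)))
        ≡⟨ sumℚ-map-− (λ j → unit j top * x j) (λ j → unit j (inject₁ k) * x j) (allFin (suc d)) ⟩
      sumℚ (map (λ j → unit j top * x j) (allFin (suc d)))
        - sumℚ (map (λ j → unit j (inject₁ k) * x j) (allFin (suc d)))
        ≡⟨ cong₂ _-_ (sumℚ-unit x top) (sumℚ-unit x (inject₁ k)) ⟩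
      x top - x (inject₁ k)
        ≡⟨ sym (φ-inject₁ x k) ⟩
      φ x (inject₁ k) ∎

  φℤ : ZPt (suc d) → ZPt (suc d)
  φℤ z = snoc (λ j → z top ℤ.- z (inject₁ j)) (z top)

  φ-ι : ∀ z → φ (ι z) ≈ₚ ι (φℤ z)
  φ-ι z = ext-fromℕ-inject₁
    (trans (φ-top (ι z)) (cong (_/ 1) (sym (snoc-fromℕ (λ j → z top ℤ.- z (inject₁ j)) (z top)))))
    λ j → begin
    φ (ι z) (inject₁ j)            ≡⟨ φ-inject₁ (ι z) j ⟩
    z top / 1 - z (inject₁ j) / 1  ≡⟨ sym (/1-homo-− (z top) (z (inject₁ j))) ⟩
    (z top ℤ.- z (inject₁ j)) / 1
      ≡⟨ cong (_/ 1) (sym (snoc-inject₁ (λ j → z top ℤ.- z (inject₁ j)) (z top) j)) ⟩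
    ι (φℤ z) (inject₁ j)           ∎
    where open ≡-Reasoning

  φ-latticePreserving : LatticePreserving φ-affineMap
  φ-latticePreserving = image∈ℤ , ℤ⊆image
    where
    image∈ℤ : ∀ z → IsLatticePt (applyAff φ-affineMap (ι z))
    image∈ℤ z = φℤ z , λ i → trans (applyAff-φ (ι z) i) (φ-ι z i)
    ℤ⊆image : ∀ w → Σ (ZPt (suc d)) λ z → applyAff φ-affineMap (ι z) ≈ₚ ι w
    ℤ⊆image w = φℤ w , λ i → begin
      applyAff φ-affineMap (ι (φℤ w)) i ≡⟨ applyAff-φ (ι (φℤ w)) i ⟩
      φ (ι (φℤ w)) i                   ≡⟨ φ-cong (λ k → sym (φ-ι w k)) i ⟩
      φ (φ (ι w)) i                    ≡⟨ φ-involutive (ι w) i ⟩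
      ι w i                            ∎
      where open ≡-Reasoning

ρ-entry : ∀ {n} (I : Fin n → Bool) i {b} → I i ≡ b → ρ I i ≡ (if b then 1ℚ else 0ℚ)
ρ-entry I i = cong (λ b → if b then 1ℚ else 0ℚ)

ρ-not : ∀ {n} (I : Fin n → Bool) i → 1ℚ - ρ I i ≡ ρ (not ∘ I) i
ρ-not I i with I i
... | true  = refl
... | false = refl

not-antitone : ∀ {a b : Bool} → (a ≡ true → b ≡ true) → not b ≡ true → not a ≡ true
not-antitone {false}         _   _  = refl
not-antitone {true}  {true}  _   ()
not-antitone {true}  {false} a⇒b _  = a⇒b refl

module IdealsOfPrime {d : ℕ} (P : Rel d) where
  open Flip {d} using (top)

  complementIdeal : (Fin d → Bool) → Fin (suc d) → Bool
  complementIdeal I = snoc (not ∘ I) true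

  complementIdeal-isIdeal : ∀ {I} → IsIdeal P I → IsIdeal (primeP P) (complementIdeal I)
  complementIdeal-isIdeal {I} _ _ _ (inj₁ refl) _ = snoc-fromℕ (not ∘ I) true
  complementIdeal-isIdeal {I} I-ideal _ _ (inj₂ (i , j , refl , refl , Pji)) s∈ =
    trans (snoc-inject₁ (not ∘ I) true i)
          (not-antitone (I-ideal i j Pji) (trans (sym (snoc-inject₁ (not ∘ I) true j)) s∈))

  complementRestriction-isIdeal : ∀ {J} → IsIdeal (primeP P) J → IsIdeal P (not ∘ J ∘ inject₁)
  complementRestriction-isIdeal J-ideal s t Pts =
    not-antitone (J-ideal (inject₁ t) (inject₁ s) (inj₂ (s , t , refl , refl , Pts)))

  ideal-without-top : ∀ {J} → IsIdeal (primeP P) J → J top ≡ false → ∀ j → J (inject₁ j) ≡ false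
  ideal-without-top {J} J-ideal top∉J j with J (inject₁ j) in j∈J
  ... | false = refl
  ... | true  = trans (sym (J-ideal (inject₁ j) top (inj₁ refl) j∈J)) top∉J

IdealVertex : ∀ {n} → Rel n → Region n
IdealVertex R x = Σ (Fin _ → Bool) λ I → IsIdeal R I × x ≈ₚ ρ I

module CayleyFlip {d : ℕ} (P : Rel d) (S : Region d) (0∈Q : conv S (λ _ → 0ℚ)) where
  open Flip {d}
  open IdealsOfPrime P

  Q : Region d
  Q = conv S

  CayleyGenerators : Region (suc d)
  CayleyGenerators = (orderPolytope P ×at 1ℚ) ∪ (Q ×at 0ℚ)

  FlippedGenerators : Region (suc d)
  FlippedGenerators = orderPolytope (primeP P) ∪ (negR Q ×at 0ℚ)

  φ₁-idealVertex : ∀ {y} → IdealVertex P y → IdealVertex (primeP P) (φ₁ y)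
  φ₁-idealVertex {y} (I , I-ideal , y≈ρI) =
    complementIdeal I , complementIdeal-isIdeal I-ideal , φ₁y≈
    where
    φ₁y≈ : φ₁ y ≈ₚ ρ (complementIdeal I)
    φ₁y≈ = ext-fromℕ-inject₁
      (trans (φ₁-top y) (sym (ρ-entry (complementIdeal I) top (snoc-fromℕ (not ∘ I) true))))
      λ j → begin
      φ₁ y (inject₁ j)                   ≡⟨ φ₁-inject₁ y j ⟩
      1ℚ - y j                           ≡⟨ cong (λ u → 1ℚ - u) (y≈ρI j) ⟩
      1ℚ - ρ I j                         ≡⟨ ρ-not I j ⟩
      ρ (not ∘ I) j
        ≡⟨ sym (ρ-entry (complementIdeal I) (inject₁ j) (snoc-inject₁ (not ∘ I) true j)) ⟩
      ρ (complementIdeal I) (inject₁ j)  ∎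
      where open ≡-Reasoning

  φ-idealVertex : ∀ {x} → IdealVertex (primeP P) x → CayleyGenerators (φ x)
  φ-idealVertex {x} (J , J-ideal , x≈ρJ) with J top in top∈J
  ... | true  =
    inj₁ (ρ J⁻ , conv-extensive (J⁻ , complementRestriction-isIdeal J-ideal , λ _ → refl) , φx≈)
    where
    J⁻ : Fin d → Bool
    J⁻ = not ∘ J ∘ inject₁
    xtop≡1 : x top ≡ 1ℚ
    xtop≡1 = trans (x≈ρJ top) (ρ-entry J top top∈J)
    φx≈ : φ x ≈ₚ snocP (ρ J⁻) 1ℚ
    φx≈ = ext-fromℕ-inject₁ (trans (φ-top x) (trans xtop≡1 (sym (snocP-fromℕ (ρ J⁻) 1ℚ))))
      λ j → begin
      φ x (inject₁ j)               ≡⟨ φ-inject₁ x j ⟩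
      x top - x (inject₁ j)         ≡⟨ cong₂ _-_ xtop≡1 (x≈ρJ (inject₁ j)) ⟩
      1ℚ - ρ J (inject₁ j)          ≡⟨ ρ-not J (inject₁ j) ⟩
      ρ J⁻ j                        ≡⟨ sym (snocP-inject₁ (ρ J⁻) 1ℚ j) ⟩
      snocP (ρ J⁻) 1ℚ (inject₁ j)   ∎
      where open ≡-Reasoning
  ... | false = inj₂ ((λ _ → 0ℚ) , 0∈Q , φx≈)
    where
    xtop≡0 : x top ≡ 0ℚ
    xtop≡0 = trans (x≈ρJ top) (ρ-entry J top top∈J)
    φx≈ : φ x ≈ₚ snocP (λ _ → 0ℚ) 0ℚ
    φx≈ = ext-fromℕ-inject₁ (trans (φ-top x) (trans xtop≡0 (sym (snocP-fromℕ {d} (λ _ → 0ℚ) 0ℚ))))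
      λ j → begin
      φ x (inject₁ j)               ≡⟨ φ-inject₁ x j ⟩
      x top - x (inject₁ j)         ≡⟨ cong₂ _-_ xtop≡0 (trans (x≈ρJ (inject₁ j))
                                          (ρ-entry J (inject₁ j) (ideal-without-top J-ideal top∈J j))) ⟩
      0ℚ - 0ℚ                       ≡⟨ sym (snocP-inject₁ {d} (λ _ → 0ℚ) 0ℚ j) ⟩
      snocP (λ _ → 0ℚ) 0ℚ (inject₁ j) ∎
      where open ≡-Reasoning

  φ-generator : ∀ {x} → CayleyGenerators x → conv FlippedGenerators (φ x)
  φ-generator (inj₁ (y , y∈O , x≈)) =
    conv-extensive (inj₁ (conv-resp-≈ₚ (λ i → sym (φ-cong x≈ i))
                           (conv-map φ₁ φ₁-cong φ₁-affine φ₁-idealVertex y∈O)))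
  φ-generator (inj₂ (y , y∈Q , x≈)) =
    conv-extensive (inj₂ ((λ j → - y j) , conv-resp-≈ₚ (λ j → sym (neg-involutive (y j))) y∈Q ,
                          φ-height₀ y x≈))

  φ-flippedGenerator : ∀ {x} → FlippedGenerators x → conv CayleyGenerators (φ x)
  φ-flippedGenerator (inj₁ x∈O′) =
    conv-idempotent (conv-map φ φ-cong φ-affine (conv-extensive ∘ φ-idealVertex) x∈O′)
  φ-flippedGenerator (inj₂ (y , -y∈Q , x≈)) =
    conv-extensive (inj₂ ((λ j → - y j) , -y∈Q , φ-height₀ y x≈))

  φ-cayley : ∀ {x} → conv CayleyGenerators x → conv FlippedGenerators (φ x)
  φ-cayley x∈C = conv-idempotent (conv-map φ φ-cong φ-affine φ-generator x∈C)

  φ-flipped : ∀ {x} → conv FlippedGenerators x → conv CayleyGenerators (φ x)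
  φ-flipped x∈F = conv-idempotent (conv-map φ φ-cong φ-affine φ-flippedGenerator x∈F)

lemma3p1 : (d : ℕ) (P : Rel d) → IsPartialOrder _≡_ P →
    (V : List (ZPt d)) → latticePolytope V (λ _ → 0ℚ) →
    UnimodEquiv (cayley (orderPolytope P) (latticePolytope V))
                (conv (orderPolytope (primeP P) ∪ (negR (latticePolytope V) ×at 0ℚ)))
lemma3p1 d P _ V 0∈Q = φ-affineMap , φ-latticePreserving , into , onto
  where
  open Flip {d}
  open CayleyFlip P _ 0∈Q
  into : ∀ x → conv CayleyGenerators x → conv FlippedGenerators (applyAff φ-affineMap x)
  into x x∈C = conv-resp-≈ₚ (λ i → sym (applyAff-φ x i)) (φ-cayley x∈C)
  onto : ∀ y → conv FlippedGenerators y →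
         Σ (Pt (suc d)) λ x → conv CayleyGenerators x × applyAff φ-affineMap x ≈ₚ y
  onto y y∈F = φ y , φ-flipped y∈F , λ i → trans (applyAff-φ (φ y) i) (φ-involutive y i)
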